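{- For all integers $r\geq2$, $\mathcal{B}_{r,1}=\mathcal{D}_{r,1}$.
   Context: A partition is a non-increasing finite sequence of positive integers (possibly empty). For a partition $\mu=(\mu_1,\dots,\mu_t)$ let $\mathrm{rect}(\mu)=\max\{h\ge0: h\le t,\ \mu_h\ge h+1\}$ (height of the horizontal Durfee rectangle, the largest rectangle with $h$ rows and $h+1$ columns in the top-left corner of the Young diagram). $\mathcal{D}_{r,1}$ is the set of partitions $\lambda$ such that, setting $\mu^{(0)}=\lambda$ and letting $\mu^{(j)}$ be $\mu^{(j-1)}$ with its first $\mathrm{rect}(\mu^{(j-1)})$ parts deleted, $\mu^{(r-1)}$ is empty. $\mathcal{B}_{r,1}$ is the set of partitions $\lambda$ such that, setting $\nu^{(0)}=\lambda$ and letting $\nu^{(j)}$ be obtained from $\nu^{(j-1)}=(\nu_1,\dots,\nu_t)$ by deleting its last $\min(\nu_t-1,t)$ parts (removal of the bottom rectangle of width $\nu_t$ and height $\nu_t-1$; nothing is done if $\nu^{(j-1)}$ is empty), $\nu^{(r-1)}$ is empty. -}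

module Defs where

open import Data.Nat using (ℕ; zero; suc; _+_; _∸_; _≤_; _<_; _≥_; _⊔_; _⊓_; _≤ᵇ_)
open import Data.Bool using (Bool; true; false; if_then_else_)
open import Data.List using (List; []; _∷_; length; drop; take; reverse; last)
open import Data.Maybe using (Maybe; just; nothing)
open import Relation.Binary.PropositionalEquality using (_≡_)
open import Data.Product using (_×_)
open import Data.Unit using (⊤)

data NonIncreasing : List ℕ → Set where
  ni-[]  : NonIncreasing []
  ni-[x] : ∀ {x} → NonIncreasing (x ∷ [])
  ni-∷   : ∀ {x y ys} → y ≤ x → NonIncreasing (y ∷ ys) → NonIncreasing (x ∷ y ∷ ys)

data AllPositive : List ℕ → Set where
  ap-[] : AllPositive []
  ap-∷  : ∀ {x xs} → 1 ≤ x → AllPositive xs → AllPositive (x ∷ xs)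

IsPartition : List ℕ → Set
IsPartition xs = NonIncreasing xs × AllPositive xs

-- rect(μ) = max { h ≥ 0 : h ≤ t, μ_h ≥ h + 1 } (1-indexed parts μ_1,...,μ_t).
-- rectFrom h μ scans the parts μ_h, μ_{h+1}, ... (μ given from index h on)
-- and returns the maximum index h' ≥ h with μ_{h'} ≥ h' + 1, or 0 if none.
rectFrom : ℕ → List ℕ → ℕ
rectFrom h []       = 0
rectFrom h (x ∷ xs) = (if suc h ≤ᵇ x then h else 0) ⊔ rectFrom (suc h) xs

rect : List ℕ → ℕ
rect μ = rectFrom 1 μ

stepD : List ℕ → List ℕ
stepD μ = drop (rect μ) μ

-- One step for B: for ν = (ν_1,...,ν_t) nonempty, delete the last
-- min(ν_t - 1, t) parts; nothing is done if ν is empty.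
stepB : List ℕ → List ℕ
stepB ν with last ν
... | nothing = ν
... | just νt = take (length ν ∸ ((νt ∸ 1) ⊓ length ν)) ν

iterate : ℕ → (List ℕ → List ℕ) → List ℕ → List ℕ
iterate zero    f x = x
iterate (suc n) f x = iterate n f (f x)

InD : ℕ → List ℕ → Set
InD r λ' = IsPartition λ' × (iterate (r ∸ 1) stepD λ' ≡ [])

InB : ℕ → List ℕ → Set
InB r λ' = IsPartition λ' × (iterate (r ∸ 1) stepB λ' ≡ [])

-- On a partition ν with t parts and smallest part ν_t, both steps delete rows from
-- one end: stepD deletes the first rect(ν) rows and stepB keeps the first
-- t ∸ (ν_t ∸ 1). For a non-increasing list rect(ν) is the length of the initial run
-- of rows with ν_i ≥ i + 1, so the two operations commute (deleting a prefix does
-- not change ν_t, keeping a prefix does not change the run), and each one empties ν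
-- exactly when ν_t ≥ t + 1. Two commuting maps that preserve partitions and empty
-- the same ones then also empty the same ones after any number of iterations.
module Submission where

open import Defs
open import Data.Nat using (ℕ; _≥_)
open import Data.List using (List)
open import Function.Bundles using (_⇔_)

open import Level using (0ℓ)
open import Data.Nat using (zero; suc; pred; _+_; _∸_; _≤_; _<_; _⊔_; _⊓_; _≤ᵇ_; z≤n; s≤s; s≤s⁻¹)
open import Data.Nat.Properties
open import Data.Bool using (true; false; if_then_else_)
open import Data.List using ([]; _∷_; length; drop; take; last)
open import Data.List.Properties using (take-all; take-[]; drop-[]; drop-all)
open import Data.List.Relation.Unary.All as All using (All; []; _∷_)
open import Data.Maybe using (just; nothing; fromMaybe)
open import Data.Product using (_,_)
open import Function.Bundles using (mk⇔; Equivalence)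
open import Function.Properties.Equivalence using (⇔-setoid)
open import Relation.Nullary using (contradiction)
open import Relation.Nullary.Reflects using (ofʸ; ofⁿ)
open import Relation.Binary.PropositionalEquality
import Relation.Binary.Reasoning.Setoid as SetoidReasoning

module ⇔-Reasoning = SetoidReasoning (⇔-setoid 0ℓ)

iterate-suc : ∀ n (f : List ℕ → List ℕ) x → iterate n f (f x) ≡ f (iterate n f x)
iterate-suc zero    f x = refl
iterate-suc (suc n) f x = iterate-suc n f (f x)

module CommutingIteration
  (P Z : List ℕ → Set) (f g : List ℕ → List ℕ)
  (f-preserves : ∀ {x} → P x → P (f x))
  (g-preserves : ∀ {x} → P x → P (g x))
  (g∘f≡f∘g : ∀ {x} → P x → g (f x) ≡ f (g x))
  (Z∘f⇔Z∘g : ∀ {x} → P x → Z (f x) ⇔ Z (g x))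
  where

  iterate-preserves : ∀ n {x} → P x → P (iterate n g x)
  iterate-preserves zero    p = p
  iterate-preserves (suc n) p = iterate-preserves n (g-preserves p)

  iterate-commute : ∀ n {x} → P x → iterate n g (f x) ≡ f (iterate n g x)
  iterate-commute zero    p = refl
  iterate-commute (suc n) p = trans (cong (iterate n g) (g∘f≡f∘g p)) (iterate-commute n (g-preserves p))

  Z∘iterate⇔ : ∀ n {x} → P x → Z (iterate n f x) ⇔ Z (iterate n g x)
  Z∘iterate⇔ zero    p = mk⇔ (λ z → z) (λ z → z)
  Z∘iterate⇔ (suc n) {x} p = begin
    Z (iterate n f (f x)) ≈⟨ Z∘iterate⇔ n (f-preserves p) ⟩
    Z (iterate n g (f x)) ≡⟨ cong Z (iterate-commute n p) ⟩
    Z (f (iterate n g x)) ≈⟨ Z∘f⇔Z∘g (iterate-preserves n p) ⟩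
    Z (g (iterate n g x)) ≡⟨ cong Z (sym (iterate-suc n g x)) ⟩
    Z (iterate n g (g x)) ∎
    where open ⇔-Reasoning

nonIncreasing-tail : ∀ {x xs} → NonIncreasing (x ∷ xs) → NonIncreasing xs
nonIncreasing-tail ni-[x]     = ni-[]
nonIncreasing-tail (ni-∷ _ p) = p

nonIncreasing-drop : ∀ k {xs} → NonIncreasing xs → NonIncreasing (drop k xs)
nonIncreasing-drop zero    p = p
nonIncreasing-drop (suc k) {[]}     p = p
nonIncreasing-drop (suc k) {x ∷ xs} p = nonIncreasing-drop k (nonIncreasing-tail p)

nonIncreasing-take : ∀ k {xs} → NonIncreasing xs → NonIncreasing (take k xs)
nonIncreasing-take zero          _            = ni-[]
nonIncreasing-take (suc k)       ni-[]        = ni-[]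
nonIncreasing-take (suc zero)    ni-[x]       = ni-[x]
nonIncreasing-take (suc (suc k)) ni-[x]       = ni-[x]
nonIncreasing-take (suc zero)    (ni-∷ _ _)   = ni-[x]
nonIncreasing-take (suc (suc k)) (ni-∷ y≤x p) = ni-∷ y≤x (nonIncreasing-take (suc k) p)

nonIncreasing⇒All≤head : ∀ {x xs} → NonIncreasing (x ∷ xs) → All (_≤ x) xs
nonIncreasing⇒All≤head ni-[x]       = []
nonIncreasing⇒All≤head (ni-∷ y≤x p) = y≤x ∷ All.map (λ z≤y → ≤-trans z≤y y≤x) (nonIncreasing⇒All≤head p)

lastPart : List ℕ → ℕ
lastPart ν = fromMaybe 0 (last ν)

lastPart≤head : ∀ {x xs} → NonIncreasing (x ∷ xs) → lastPart (x ∷ xs) ≤ x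
lastPart≤head ni-[x]       = ≤-refl
lastPart≤head (ni-∷ y≤x p) = ≤-trans (lastPart≤head p) y≤x

rectRun : ℕ → List ℕ → ℕ
rectRun h []       = 0
rectRun h (x ∷ xs) = if suc h ≤ᵇ x then suc (rectRun (suc h) xs) else 0

lastRow : ℕ → ℕ → ℕ
lastRow h zero    = 0
lastRow h (suc c) = h + c

rectFrom-below : ∀ {h xs} → All (_≤ h) xs → rectFrom h xs ≡ 0
rectFrom-below [] = refl
rectFrom-below {h} {x ∷ _} (x≤h ∷ xs≤h) with suc h ≤ᵇ x | ≤ᵇ-reflects-≤ (suc h) x
... | true  | ofʸ h<x = contradiction x≤h (<⇒≱ h<x)
... | false | ofⁿ _   = rectFrom-below (All.map m≤n⇒m≤1+n xs≤h)

⊔-lastRow : ∀ h c → h ⊔ lastRow (suc h) c ≡ h + c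
⊔-lastRow h zero    = trans (⊔-identityʳ h) (sym (+-identityʳ h))
⊔-lastRow h (suc c) = trans (m≤n⇒m⊔n≡n (≤-trans (n≤1+n h) (m≤m+n (suc h) c))) (sym (+-suc h c))

rectFrom≡lastRow∘rectRun : ∀ {h xs} → NonIncreasing xs → rectFrom h xs ≡ lastRow h (rectRun h xs)
rectFrom≡lastRow∘rectRun {h} {[]}    _  = refl
rectFrom≡lastRow∘rectRun {h} {x ∷ _} ν↓ with suc h ≤ᵇ x | ≤ᵇ-reflects-≤ (suc h) x
... | false | ofⁿ h≮x =
  rectFrom-below (All.map (λ y≤x → ≤-trans y≤x (<⇒≤ (≰⇒> h≮x))) (nonIncreasing⇒All≤head ν↓))
... | true  | ofʸ _   =
  trans (cong (h ⊔_) (rectFrom≡lastRow∘rectRun (nonIncreasing-tail ν↓))) (⊔-lastRow h _)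

rect≡rectRun : ∀ {ν} → NonIncreasing ν → rect ν ≡ rectRun 1 ν
rect≡rectRun {ν} ν↓ = trans (rectFrom≡lastRow∘rectRun ν↓) (lastRow-1 (rectRun 1 ν))
  where
  lastRow-1 : ∀ c → lastRow 1 c ≡ c
  lastRow-1 zero    = refl
  lastRow-1 (suc c) = refl

rectRun-take : ∀ h m xs → rectRun h (take m xs) ≡ rectRun h xs ⊓ m
rectRun-take h zero    xs       = sym (⊓-zeroʳ (rectRun h xs))
rectRun-take h (suc m) []       = refl
rectRun-take h (suc m) (x ∷ xs) with suc h ≤ᵇ x
... | true  = cong suc (rectRun-take (suc h) m xs)
... | false = refl

-- Parts decrease while the thresholds h + i increase, so the run covers the whole
-- list as soon as the last part clears its threshold.
rectRun-complete : ∀ h {x xs} → NonIncreasing (x ∷ xs) →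
                   length (x ∷ xs) ≤ rectRun h (x ∷ xs) ⇔ h + length (x ∷ xs) ≤ lastPart (x ∷ xs)
rectRun-complete h {x} {xs} ν↓ with suc h ≤ᵇ x | ≤ᵇ-reflects-≤ (suc h) x
... | false | ofⁿ h≮x = mk⇔ (λ ()) λ h+t≤last →
  contradiction (≤-trans (s≤s (m≤m+n h (length xs))) (≤-trans (≤-reflexive (sym (+-suc h _)))
                  (≤-trans h+t≤last (lastPart≤head ν↓)))) h≮x
rectRun-complete h {x} {[]}     ν↓           | true | ofʸ h<x =
  mk⇔ (λ _ → ≤-trans (≤-reflexive (+-comm h 1)) h<x) (λ _ → ≤-refl)
rectRun-complete h {x} {y ∷ ys} (ni-∷ _ ν↓) | true | ofʸ _   = begin
  suc (length (y ∷ ys)) ≤ suc (rectRun (suc h) (y ∷ ys)) ≈⟨ mk⇔ s≤s⁻¹ s≤s ⟩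
  length (y ∷ ys) ≤ rectRun (suc h) (y ∷ ys)             ≈⟨ rectRun-complete (suc h) ν↓ ⟩
  suc h + length (y ∷ ys) ≤ lastPart (y ∷ ys)            ≡⟨ cong (_≤ lastPart (y ∷ ys)) (sym (+-suc h _)) ⟩
  h + suc (length (y ∷ ys)) ≤ lastPart (y ∷ ys)          ∎
  where open ⇔-Reasoning

m∸[n⊓m]≡m∸n : ∀ m n → m ∸ (n ⊓ m) ≡ m ∸ n
m∸[n⊓m]≡m∸n m n = begin
  m ∸ (n ⊓ m)           ≡⟨ ∸-distribˡ-⊓-⊔ m n m ⟩
  (m ∸ n) ⊔ (m ∸ m)     ≡⟨ cong ((m ∸ n) ⊔_) (n∸n≡0 m) ⟩
  (m ∸ n) ⊔ 0           ≡⟨ ⊔-identityʳ (m ∸ n) ⟩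
  m ∸ n                 ∎
  where open ≡-Reasoning

[1+m]∸n∸[1+o]≡m∸n∸o : ∀ m n o → suc m ∸ n ∸ suc o ≡ m ∸ n ∸ o
[1+m]∸n∸[1+o]≡m∸n∸o m n o = begin
  suc m ∸ n ∸ suc o     ≡⟨ ∸-+-assoc (suc m) n (suc o) ⟩
  suc m ∸ (n + suc o)   ≡⟨ cong (suc m ∸_) (+-suc n o) ⟩
  m ∸ (n + o)           ≡⟨ ∸-+-assoc m n o ⟨
  m ∸ n ∸ o             ∎
  where open ≡-Reasoning

stepB-take : ∀ ν → stepB ν ≡ take (length ν ∸ (lastPart ν ∸ 1)) ν
stepB-take ν with last ν
... | nothing = sym (take-all (length ν) ν ≤-refl)
... | just νt = cong (λ k → take k ν) (m∸[n⊓m]≡m∸n (length ν) (νt ∸ 1))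

stepB-drop : ∀ c ν → stepB (drop c ν) ≡ take (length ν ∸ (lastPart ν ∸ 1) ∸ c) (drop c ν)
stepB-drop zero    ν            = stepB-take ν
stepB-drop (suc c) []           = refl
stepB-drop (suc c) (x ∷ [])     rewrite drop-[] {A = ℕ} c = sym (take-[] _)
stepB-drop (suc c) (x ∷ y ∷ ys) =
  trans (stepB-drop c (y ∷ ys))
        (cong (λ k → take k (drop c (y ∷ ys)))
              (sym ([1+m]∸n∸[1+o]≡m∸n∸o (length (y ∷ ys)) (lastPart (y ∷ ys) ∸ 1) c)))

drop-⊓-take : ∀ c m (xs : List ℕ) → drop (c ⊓ m) (take m xs) ≡ drop c (take m xs)
drop-⊓-take zero    m       xs       = refl
drop-⊓-take (suc c) zero    xs       = sym (drop-[] (suc c))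
drop-⊓-take (suc c) (suc m) []       = refl
drop-⊓-take (suc c) (suc m) (x ∷ xs) = drop-⊓-take c m xs

drop-take : ∀ c m (xs : List ℕ) → drop c (take m xs) ≡ take (m ∸ c) (drop c xs)
drop-take zero    m       xs       = refl
drop-take (suc c) zero    xs       = drop-[] (suc c)
drop-take (suc c) (suc m) []       = sym (take-[] (m ∸ c))
drop-take (suc c) (suc m) (x ∷ xs) = drop-take c m xs

stepD∘stepB≡stepB∘stepD : ∀ {ν} → NonIncreasing ν → stepD (stepB ν) ≡ stepB (stepD ν)
stepD∘stepB≡stepB∘stepD {ν} ν↓ = begin
  stepD (stepB ν)                   ≡⟨ cong stepD (stepB-take ν) ⟩
  drop (rect (take m ν)) (take m ν) ≡⟨ cong (λ k → drop k (take m ν)) rect-take ⟩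
  drop (c ⊓ m) (take m ν)           ≡⟨ drop-⊓-take c m ν ⟩
  drop c (take m ν)                 ≡⟨ drop-take c m ν ⟩
  take (m ∸ c) (drop c ν)           ≡⟨ stepB-drop c ν ⟨
  stepB (drop c ν)                  ≡⟨ cong (λ k → stepB (drop k ν)) (rect≡rectRun ν↓) ⟨
  stepB (stepD ν)                   ∎
  where
  open ≡-Reasoning
  m = length ν ∸ (lastPart ν ∸ 1)
  c = rectRun 1 ν
  rect-take : rect (take m ν) ≡ c ⊓ m
  rect-take = trans (rect≡rectRun (nonIncreasing-take m ν↓)) (rectRun-take 1 m ν)

suc[m]≤pred[n]⇔suc[m]<n : ∀ {m n} → suc m ≤ pred n ⇔ suc m < n
suc[m]≤pred[n]⇔suc[m]<n {n = zero}  = mk⇔ (λ ()) (λ ())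
suc[m]≤pred[n]⇔suc[m]<n {n = suc n} = mk⇔ s≤s s≤s⁻¹

take-∷≡[]⇔ : ∀ k {x} {xs : List ℕ} → take k (x ∷ xs) ≡ [] ⇔ k ≡ 0
take-∷≡[]⇔ zero    = mk⇔ (λ _ → refl) (λ _ → refl)
take-∷≡[]⇔ (suc k) = mk⇔ (λ ()) (λ ())

drop≡[]⇒length≤ : ∀ k (xs : List ℕ) → drop k xs ≡ [] → length xs ≤ k
drop≡[]⇒length≤ k       []       _  = z≤n
drop≡[]⇒length≤ (suc k) (x ∷ xs) eq = s≤s (drop≡[]⇒length≤ k xs eq)

stepB≡[]⇔stepD≡[] : ∀ {ν} → NonIncreasing ν → stepB ν ≡ [] ⇔ stepD ν ≡ []
stepB≡[]⇔stepD≡[] {[]}        _  = mk⇔ (λ _ → refl) (λ _ → refl)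
stepB≡[]⇔stepD≡[] {ν@(_ ∷ _)} ν↓ = begin
  stepB ν ≡ []              ≡⟨ cong (_≡ []) (stepB-take ν) ⟩
  take (t ∸ pred L) ν ≡ []  ≈⟨ take-∷≡[]⇔ (t ∸ pred L) ⟩
  t ∸ pred L ≡ 0            ≈⟨ mk⇔ m∸n≡0⇒m≤n m≤n⇒m∸n≡0 ⟩
  t ≤ pred L                ≈⟨ suc[m]≤pred[n]⇔suc[m]<n ⟩
  1 + t ≤ L                 ≈⟨ rectRun-complete 1 ν↓ ⟨
  t ≤ rectRun 1 ν           ≡⟨ cong (t ≤_) (rect≡rectRun ν↓) ⟨
  t ≤ rect ν                ≈⟨ mk⇔ (drop-all (rect ν) ν) (drop≡[]⇒length≤ (rect ν) ν) ⟩
  stepD ν ≡ []              ∎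
  where
  open ⇔-Reasoning
  t = length ν
  L = lastPart ν

stepB-nonIncreasing : ∀ {ν} → NonIncreasing ν → NonIncreasing (stepB ν)
stepB-nonIncreasing {ν} ν↓ = subst NonIncreasing (sym (stepB-take ν)) (nonIncreasing-take _ ν↓)

open CommutingIteration NonIncreasing (_≡ []) stepB stepD
  stepB-nonIncreasing (λ {ν} → nonIncreasing-drop (rect ν)) stepD∘stepB≡stepB∘stepD stepB≡[]⇔stepD≡[]

theorem3p5 : (r : ℕ) → r ≥ 2 → (λ' : List ℕ) → InB r λ' ⇔ InD r λ'
theorem3p5 r _ λ' = mk⇔
  (λ { (λ'-partition , B-empty) → λ'-partition , Equivalence.to   (B⇔D λ'-partition) B-empty })
  (λ { (λ'-partition , D-empty) → λ'-partition , Equivalence.from (B⇔D λ'-partition) D-empty })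
  where
  B⇔D : IsPartition λ' → iterate (r ∸ 1) stepB λ' ≡ [] ⇔ iterate (r ∸ 1) stepD λ' ≡ []
  B⇔D (λ'↓ , _) = Z∘iterate⇔ (r ∸ 1) λ'↓
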